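{- Let $q$ be a prime power and $\vec{B}=(\vec{b}_1;\dots;\vec{b}_k)\in\mathbb{F}_q^{p\beta\times n}$ (so $k=p\beta$) a $\beta$-slide-reduced basis. Let $c_1:=|\vec{b}_1|$, $w_i:=s_q(c_i,\beta)$ and \[c_{i+1}:=\left\lceil\frac{(q-1)(w_i-c_i)}{q^\beta-q}\right\rceil.\] Then $n\ge w_1+w_2+\dots+w_p$.
   Context: $s_q(d,k)$ is the minimal $n$ such that a linear code in $\mathbb{F}_q^n$ of dimension $k$ and minimum distance $d$ exists. $|\vec{x}|$ Hamming weight, $\mathsf{Supp}$ support. $\pi^\perp_{\{\vec{x}_1,\dots,\vec{x}_m\}}$ zeroes coordinates in the union of supports; $\pi_i:=\pi^\perp_{\{\vec{b}_1,\dots,\vec{b}_{i-1}\}}$, $\vec{b}_i^+:=\pi_i(\vec{b}_i)$, $\vec{B}_{[i,j]}:=(\pi_i(\vec{b}_i);\dots;\pi_i(\vec{b}_j))$. Proper: all $\vec{b}_i^+\ne\vec0$. Forward reduced: first vector is a shortest nonzero codeword of the generated code. For a code $\mathcal{D}$, $S$ is redundant if $S\subseteq\mathsf{Supp}(\mathcal{D})$ and for all $\vec{c}\in\mathcal{D}$, $i,j\in S$: $c_i=0\iff c_j=0$; $\eta(\mathcal{D})$ is the max size of a redundant set. Backward reduced: proper and last epipodal vector has length $\eta$ of the generated code. $\vec{B}$ with $k=p\beta$ rows is $\beta$-slide reduced if it is proper, $\vec{B}_{[i\beta+1,(i+1)\beta]}$ is forward reduced for all $i\in[0,k/\beta-1]$,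 and $\vec{B}_{[i\beta+2,(i+1)\beta+1]}$ is backward reduced for all $i\in[0,k/\beta-2]$. -}

module Defs where

open import Level using (0ℓ) renaming (suc to lsuc)
open import Algebra.Bundles using (CommutativeRing)
open import Data.Nat as ℕ using (ℕ; zero; suc; _≤_; _<_; _<?_; z≤n; s≤s)
open import Data.Nat.DivMod using (_/_)
open import Data.Fin as Fin using (Fin; toℕ; fromℕ; fromℕ<; inject)
open import Data.Fin.Subset using (Subset; _∈_; ∣_∣)
open import Data.Product using (Σ; ∃; _×_; _,_)
open import Data.Empty using (⊥)
open import Relation.Nullary using (¬_; yes; no)
open import Relation.Binary using (Decidable)
open import Relation.Binary.PropositionalEquality using (_≡_)
open import Function.Bundles using (_⇔_)

record FiniteField (q : ℕ) : Set₁ where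
  field
    commRing : CommutativeRing 0ℓ 0ℓ
  open CommutativeRing commRing public
  field
    _≟_      : Decidable _≈_
    0≉1      : ¬ (0# ≈ 1#)
    inverse  : ∀ x → ¬ (x ≈ 0#) → ∃ λ y → x * y ≈ 1#
    enum     : Fin q → Carrier
    enum-inj : ∀ i j → enum i ≈ enum j → i ≡ j
    enum-sur : ∀ x → ∃ λ i → enum i ≈ x

-- ceiling division (the value for divisor 0 is irrelevant junk)
⌈_/_⌉ : ℕ → ℕ → ℕ
⌈ a / zero ⌉ = 0
⌈ a / suc b ⌉ = (a ℕ.+ b) / suc b

sumTo : (ℕ → ℕ) → ℕ → ℕ
sumTo w zero = 0
sumTo w (suc p) = sumTo w p ℕ.+ w p

module Codes {q : ℕ} (F : FiniteField q) where
  open FiniteField F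

  Word : ℕ → Set
  Word n = Fin n → Carrier

  Fam : ℕ → ℕ → Set
  Fam n m = Fin m → Word n

  zeroW : ∀ {n} → Word n
  zeroW _ = 0#

  IsZero : ∀ {n} → Word n → Set
  IsZero v = ∀ i → v i ≈ 0#

  NonZero : ∀ {n} → Word n → Set
  NonZero v = ¬ IsZero v

  wt : ∀ {n} → Word n → ℕ
  wt {zero} v = 0
  wt {suc n} v with v Fin.zero ≟ 0#
  ... | yes _ = wt (λ i → v (Fin.suc i))
  ... | no  _ = suc (wt (λ i → v (Fin.suc i)))

  lincomb : ∀ {n m} → (Fin m → Carrier) → Fam n m → Word n
  lincomb {m = zero} a X i = 0#
  lincomb {m = suc m} a X i =
    a Fin.zero * X Fin.zero i + lincomb (λ l → a (Fin.suc l)) (λ l → X (Fin.suc l)) i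

  InSpan : ∀ {n m} → Fam n m → Word n → Set
  InSpan X v = ∃ λ a → ∀ i → v i ≈ lincomb a X i

  LinIndep : ∀ {n m} → Fam n m → Set
  LinIndep X = ∀ a → IsZero (lincomb a X) → ∀ l → a l ≈ 0#

  zeroOut : ∀ {n} → Word n → Word n → Word n
  zeroOut x v i with x i ≟ 0#
  ... | yes _ = v i
  ... | no  _ = 0#

  -- π^⊥_{X_0,...,X_{m-1}} : zero out the union of the supports
  proj⊥ : ∀ {n} (m : ℕ) → Fam n m → Word n → Word n
  proj⊥ zero X v = v
  proj⊥ (suc m) X v = zeroOut (X Fin.zero) (proj⊥ m (λ l → X (Fin.suc l)) v)

  epi : ∀ {n m} → Fam n m → Fin m → Word n
  epi X l = proj⊥ (toℕ l) (λ j → X (inject j)) (X l)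

  Proper : ∀ {n m} → Fam n m → Set
  Proper X = ∀ l → NonZero (epi X l)

  ForwardReduced : ∀ {n m} → Fam n m → Set
  ForwardReduced {m = zero} X = ⊥
  ForwardReduced {m = suc m} X =
    NonZero (X Fin.zero) ×
    (∀ v → InSpan X v → NonZero v → wt (X Fin.zero) ≤ wt v)

  InSupp : ∀ {n m} → Fam n m → Fin n → Set
  InSupp X i = ∃ λ v → InSpan X v × ¬ (v i ≈ 0#)

  Redundant : ∀ {n m} → Fam n m → Subset n → Set
  Redundant X S =
    (∀ i → i ∈ S → InSupp X i) ×
    (∀ v → InSpan X v → ∀ i j → i ∈ S → j ∈ S → (v i ≈ 0# ⇔ v j ≈ 0#))

  IsEta : ∀ {n m} → Fam n m → ℕ → Set
  IsEta X e =
    (∃ λ S → Redundant X S × ∣ S ∣ ≡ e) ×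
    (∀ S → Redundant X S → ∣ S ∣ ≤ e)

  BackwardReduced : ∀ {n m} → Fam n m → Set
  BackwardReduced {m = zero} X = ⊥
  BackwardReduced {m = suc m} X = Proper X × IsEta X (wt (epi X (fromℕ m)))

  CodeExists : (s k d : ℕ) → Set
  CodeExists s k d =
    Σ (Fam s k) λ G → LinIndep G ×
      (∃ λ v → InSpan G v × NonZero v × wt v ≡ d) ×
      (∀ v → InSpan G v → NonZero v → d ≤ wt v)

  IsS : (d k s : ℕ) → Set
  IsS d k s = CodeExists s k d × (∀ s′ → CodeExists s′ k d → s ≤ s′)

  -- 0-indexed access to the rows of a k-row basis (zero outside range,
  -- only ever used inside the range)
  at : ∀ {n k} → Fam n k → ℕ → Word n
  at {k = k} B j with j <? k
  ... | yes j<k = B (fromℕ< j<k)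
  ... | no  _   = zeroW

  -- block B_[a+1, a+m] (1-indexed) = (π_{a+1}(b_{a+1}); ...; π_{a+1}(b_{a+m}))
  block : ∀ {n k} → Fam n k → (a m : ℕ) → Fam n m
  block B a m l = proj⊥ a (λ j → at B (toℕ j)) (at B (a ℕ.+ toℕ l))

  SlideReduced : ∀ {n} (p β : ℕ) → Fam n (p ℕ.* β) → Set
  SlideReduced p β B =
    Proper B ×
    (∀ i → i < p → ForwardReduced (block B (i ℕ.* β) β)) ×
    (∀ i → suc i < p → BackwardReduced (block B (i ℕ.* β ℕ.+ 1) β))

  first : ∀ {p β} → 1 ≤ p → 2 ≤ β → Fin (p ℕ.* β)
  first {suc p} {suc β} _ _ = Fin.zero

-- Index blocks from 0, let d_i be the weight of the epipodal vector opening block i, and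
-- let K_i (resp. T_i) be the coordinates outside the supports of all vectors before block i
-- (resp. before its second vector) that lie in the support of some vector of block i.
-- Projected away from the earlier blocks, block i is a forward-reduced basis of a code of
-- dimension β and distance d_i supported on K_i.  If c_i ≤ d_i, puncturing it d_i − c_i times
-- inside a minimum-weight word gives w_i + (d_i − c_i) ≤ |K_i|; as K_i ∖ T_i lies in the support
-- of the opening epipodal vector, also w_i − c_i ≤ |T_i|.  On T_i the columns of the
-- backward-reduced window starting at the second vector of block i are nonzero above its last
-- row, so they fall into at most (q^β − q)/(q − 1) projective classes, each a redundant set of
-- size at most η = d_{i+1}.  Hence (q − 1)(w_i − c_i) ≤ (q^β − q) d_{i+1}, i.e. c_{i+1} ≤ d_{i+1},
-- and by induction from c_0 = d_0 every w_i ≤ |K_i|; the K_i are disjoint, so Σ w_i ≤ n.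

module Submission where

open import Defs
open import Data.Nat using (ℕ; zero; suc; _+_; _*_; _∸_; _^_; _≤_; _<_; z≤n; s≤s; s≤s⁻¹; _<?_)
import Data.Nat.Properties as ℕ
open import Data.Nat.DivMod using (_%_; m<n*o⇒m/o<n; [m+kn]%n≡m%n; m<n⇒m%n≡m)
open import Data.Nat.Tactic.RingSolver using (solve-∀)
open import Data.Fin using (Fin; zero; suc; toℕ; fromℕ; fromℕ<; inject; inject₁; punchIn; _↑ˡ_; _↑ʳ_)
import Data.Fin.Properties as Fin
open import Data.Fin.Subset using (Subset; inside; outside; _∈_; _∉_; _⊆_; _∩_; ∁; ∣_∣)
open import Data.Fin.Subset.Properties
  using (drop-there; x∈p∩q⁺; x∈p∩q⁻; x∈∁p⇒x∉p; x∉p⇒x∈∁p; p⊆q⇒∣p∣≤∣q∣; ∣p∩q∣≤∣q∣; Empty-unique; ∣⊥∣≡0; ∣p∣≤n)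
open import Data.Vec using ([]; _∷_; here; there)
open import Data.Product using (∃; Σ; _×_; _,_; proj₁; proj₂)
open import Data.Sum using (inj₁; inj₂)
open import Data.Empty using (⊥-elim)
open import Function using (_∘_)
open import Function.Bundles using (_⇔_; mk⇔)
open import Relation.Nullary using (¬_; ¬?; Dec; yes; no; does; contradiction)
open import Relation.Unary using (Pred; Decidable)
open import Relation.Binary.PropositionalEquality as ≡ using (_≡_; cong)
import Relation.Binary.Reasoning.Setoid

subset : ∀ {n ℓ} {P : Pred (Fin n) ℓ} → Decidable P → Subset n
subset {zero} P? = []
subset {suc n} P? = does (P? zero) ∷ subset (P? ∘ suc)

∈-subset⁺ : ∀ {n ℓ} {P : Pred (Fin n) ℓ} (P? : Decidable P) {j} → P j → j ∈ subset P?
∈-subset⁺ P? {zero} Pj with P? zero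
... | yes _ = here
... | no ¬Pj = contradiction Pj ¬Pj
∈-subset⁺ P? {suc j} Pj = there (∈-subset⁺ (P? ∘ suc) Pj)

∈-subset⁻ : ∀ {n ℓ} {P : Pred (Fin n) ℓ} (P? : Decidable P) {j} → j ∈ subset P? → P j
∈-subset⁻ P? {zero} j∈ with P? zero
∈-subset⁻ P? {zero} j∈ | yes Pj = Pj
∈-subset⁻ P? {zero} () | no _
∈-subset⁻ P? {suc j} (there j∈) = ∈-subset⁻ (P? ∘ suc) j∈

∣p∣≡∣p∩q∣+∣p∩∁q∣ : ∀ {n} (p q : Subset n) → ∣ p ∣ ≡ ∣ p ∩ q ∣ + ∣ p ∩ ∁ q ∣
∣p∣≡∣p∩q∣+∣p∩∁q∣ [] [] = ≡.refl
∣p∣≡∣p∩q∣+∣p∩∁q∣ (inside ∷ p) (inside ∷ q) = cong suc (∣p∣≡∣p∩q∣+∣p∩∁q∣ p q)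
∣p∣≡∣p∩q∣+∣p∩∁q∣ (inside ∷ p) (outside ∷ q) =
  ≡.trans (cong suc (∣p∣≡∣p∩q∣+∣p∩∁q∣ p q)) (≡.sym (ℕ.+-suc _ _))
∣p∣≡∣p∩q∣+∣p∩∁q∣ (outside ∷ p) (_ ∷ q) = ∣p∣≡∣p∩q∣+∣p∩∁q∣ p q

∣p∣≤∣q∣+∣p∩∁q∣ : ∀ {n} (p q : Subset n) → ∣ p ∣ ≤ ∣ q ∣ + ∣ p ∩ ∁ q ∣
∣p∣≤∣q∣+∣p∩∁q∣ p q = begin
  ∣ p ∣                       ≡⟨ ∣p∣≡∣p∩q∣+∣p∩∁q∣ p q ⟩
  ∣ p ∩ q ∣ + ∣ p ∩ ∁ q ∣     ≤⟨ ℕ.+-monoˡ-≤ ∣ p ∩ ∁ q ∣ (∣p∩q∣≤∣q∣ p q) ⟩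
  ∣ q ∣ + ∣ p ∩ ∁ q ∣         ∎
  where open ℕ.≤-Reasoning

q⊆p⇒∣p∩∁q∣+∣q∣≤∣p∣ : ∀ {n} {p q : Subset n} → q ⊆ p → ∣ p ∩ ∁ q ∣ + ∣ q ∣ ≤ ∣ p ∣
q⊆p⇒∣p∩∁q∣+∣q∣≤∣p∣ {p = p} {q} q⊆p = begin
  ∣ p ∩ ∁ q ∣ + ∣ q ∣         ≡⟨ ℕ.+-comm ∣ p ∩ ∁ q ∣ ∣ q ∣ ⟩
  ∣ q ∣ + ∣ p ∩ ∁ q ∣         ≤⟨ ℕ.+-monoˡ-≤ ∣ p ∩ ∁ q ∣ (p⊆q⇒∣p∣≤∣q∣ (λ x∈q → x∈p∩q⁺ (q⊆p x∈q , x∈q))) ⟩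
  ∣ p ∩ q ∣ + ∣ p ∩ ∁ q ∣     ≡⟨ ∣p∣≡∣p∩q∣+∣p∩∁q∣ p q ⟨
  ∣ p ∣                       ∎
  where open ℕ.≤-Reasoning

fiber : ∀ {n} → (Fin n → ℕ) → ℕ → Subset n
fiber f u = subset (λ j → f j ℕ.≟ u)

pigeonhole-fibers : ∀ {n} m {e} (f : Fin n → ℕ) (p : Subset n)
  → (∀ {j} → j ∈ p → f j < m) → (∀ u → ∣ p ∩ fiber f u ∣ ≤ e) → ∣ p ∣ ≤ m * e
pigeonhole-fibers {n} zero f p f<0 _ =
  ℕ.≤-reflexive (≡.trans (cong ∣_∣ (Empty-unique (λ (_ , j∈p) → ℕ.n≮0 (f<0 j∈p)))) (∣⊥∣≡0 n))
pigeonhole-fibers (suc m) {e} f p f<m+1 fibers≤e = begin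
  ∣ p ∣                          ≡⟨ ∣p∣≡∣p∩q∣+∣p∩∁q∣ p (fiber f m) ⟩
  ∣ p ∩ fiber f m ∣ + ∣ rest ∣   ≤⟨ ℕ.+-mono-≤ (fibers≤e m) (pigeonhole-fibers m f rest f<m rest-fibers≤e) ⟩
  e + m * e                      ∎
  where
  open ℕ.≤-Reasoning
  rest = p ∩ ∁ (fiber f m)
  f<m : ∀ {j} → j ∈ rest → f j < m
  f<m j∈ with x∈p∩q⁻ p _ j∈
  ... | j∈p , j∈∁ = ℕ.≤∧≢⇒< (s≤s⁻¹ (f<m+1 j∈p)) (x∈∁p⇒x∉p j∈∁ ∘ ∈-subset⁺ _)
  rest-fibers≤e : ∀ u → ∣ rest ∩ fiber f u ∣ ≤ e
  rest-fibers≤e u = ℕ.≤-trans (p⊆q⇒∣p∣≤∣q∣ shrink) (fibers≤e u)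
    where
    shrink : rest ∩ fiber f u ⊆ p ∩ fiber f u
    shrink j∈ with x∈p∩q⁻ rest _ j∈
    ... | j∈rest , j∈u = x∈p∩q⁺ (proj₁ (x∈p∩q⁻ p _ j∈rest) , j∈u)

⌈/⌉≤ : ∀ a b e → a ≤ b * e → ⌈ a / b ⌉ ≤ e
⌈/⌉≤ a zero e _ = z≤n
⌈/⌉≤ a (suc b) e a≤be = s≤s⁻¹ (m<n*o⇒m/o<n (begin-strict
  a + b           ≡⟨ ℕ.+-comm a b ⟩
  b + a           <⟨ s≤s (ℕ.+-monoʳ-≤ b (ℕ.≤-trans a≤be (ℕ.≤-reflexive (ℕ.*-comm (suc b) e)))) ⟩
  suc e * suc b   ∎))
  where open ℕ.≤-Reasoning

geometric-series : ∀ q m → (q ∸ 1) * sumTo (λ t → q ^ suc t) m ≡ q ^ suc m ∸ q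
geometric-series zero m = ≡.refl
geometric-series (suc q-1) m = begin
  q-1 * S m                        ≡⟨ ℕ.m+n∸n≡m _ (suc q-1) ⟨
  q-1 * S m + suc q-1 ∸ suc q-1    ≡⟨ cong (_∸ suc q-1) (closed m) ⟩
  suc q-1 ^ suc m ∸ suc q-1        ∎
  where
  open ≡.≡-Reasoning
  S : ℕ → ℕ
  S = sumTo (λ t → suc q-1 ^ suc t)
  closed : ∀ m → q-1 * S m + suc q-1 ≡ suc q-1 ^ suc m
  closed zero = base q-1
    where
    base : ∀ x → x * 0 + suc x ≡ suc x * 1
    base = solve-∀
  closed (suc m) = begin
    q-1 * (S m + Q) + suc q-1        ≡⟨ regroup q-1 (S m) Q ⟩
    (q-1 * S m + suc q-1) + q-1 * Q  ≡⟨ cong (_+ q-1 * Q) (closed m) ⟩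
    Q + q-1 * Q                      ∎
    where
    Q = suc q-1 ^ suc m
    regroup : ∀ x s y → x * (s + y) + suc x ≡ (x * s + suc x) + x * y
    regroup = solve-∀

digits-injective : ∀ {q a a′ e e′} → a < q → a′ < q → a + q * e ≡ a′ + q * e′ → a ≡ a′ × e ≡ e′
digits-injective {suc q-1} {a} {a′} {e} {e′} a<q a′<q eq = a≡a′ , e≡e′
  where
  open ≡.≡-Reasoning
  q = suc q-1
  a≡a′ : a ≡ a′
  a≡a′ = begin
    a                    ≡⟨ m<n⇒m%n≡m a<q ⟨
    a % q                ≡⟨ [m+kn]%n≡m%n a e q ⟨
    (a + e * q) % q      ≡⟨ cong (λ t → (a + t) % q) (ℕ.*-comm e q) ⟩
    (a + q * e) % q      ≡⟨ cong (_% q) eq ⟩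
    (a′ + q * e′) % q    ≡⟨ cong (λ t → (a′ + t) % q) (ℕ.*-comm q e′) ⟩
    (a′ + e′ * q) % q    ≡⟨ [m+kn]%n≡m%n a′ e′ q ⟩
    a′ % q               ≡⟨ m<n⇒m%n≡m a′<q ⟩
    a′                   ∎
  e≡e′ : e ≡ e′
  e≡e′ = ℕ.*-cancelˡ-≡ e e′ q (ℕ.+-cancelˡ-≡ a _ _ (≡.trans eq (cong (_+ q * e′) (≡.sym a≡a′))))

w+[d∸c]≤t+d⇒w∸c≤t : ∀ {w c d t} → c ≤ d → w + (d ∸ c) ≤ t + d → w ∸ c ≤ t
w+[d∸c]≤t+d⇒w∸c≤t {w} {c} {d} {t} c≤d le = ℕ.m≤n+o⇒m∸n≤o w c (ℕ.+-cancelʳ-≤ (d ∸ c) w (c + t) (begin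
  w + (d ∸ c)        ≤⟨ le ⟩
  t + d              ≡⟨ cong (t +_) (ℕ.m∸n+n≡m c≤d) ⟨
  t + (d ∸ c + c)    ≡⟨ regroup t (d ∸ c) c ⟩
  c + t + (d ∸ c)    ∎))
  where
  open ℕ.≤-Reasoning
  regroup : ∀ t x c → t + (x + c) ≡ c + t + x
  regroup = solve-∀

module _ {q : ℕ} (F : FiniteField q) where

  open FiniteField F
    renaming (_+_ to _+ᶠ_; _*_ to _·_; refl to ≈-refl; sym to ≈-sym; trans to ≈-trans; zero to ·-zero)
  open Codes F
  private module ≈-Reasoning = Relation.Binary.Reasoning.Setoid setoid

  x≉0∧x·y≈0⇒y≈0 : ∀ {x y} → ¬ x ≈ 0# → x · y ≈ 0# → y ≈ 0#
  x≉0∧x·y≈0⇒y≈0 {x} {y} x≉0 xy≈0 with inverse x x≉0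
  ... | x⁻¹ , x·x⁻¹≈1 = begin
    y               ≈⟨ *-identityˡ y ⟨
    1# · y          ≈⟨ *-congʳ (≈-trans (≈-sym x·x⁻¹≈1) (*-comm x x⁻¹)) ⟩
    (x⁻¹ · x) · y   ≈⟨ *-assoc x⁻¹ x y ⟩
    x⁻¹ · (x · y)   ≈⟨ *-congˡ xy≈0 ⟩
    x⁻¹ · 0#        ≈⟨ proj₂ ·-zero x⁻¹ ⟩
    0#              ∎
    where open ≈-Reasoning

  x·y≈1⇒y≉0 : ∀ {x y} → x · y ≈ 1# → ¬ y ≈ 0#
  x·y≈1⇒y≉0 {x} x·y≈1 y≈0 = 0≉1 (≈-trans (≈-sym (≈-trans (*-congˡ y≈0) (proj₂ ·-zero x))) x·y≈1)

  x≉0∧y≉0⇒x·y≉0 : ∀ {x y} → ¬ x ≈ 0# → ¬ y ≈ 0# → ¬ x · y ≈ 0#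
  x≉0∧y≉0⇒x·y≉0 x≉0 y≉0 = y≉0 ∘ x≉0∧x·y≈0⇒y≈0 x≉0

  isZero? : ∀ {n} (v : Word n) → Dec (IsZero v)
  isZero? v = Fin.all? (λ i → v i ≟ 0#)

  nonzeroEntry : ∀ {n} (v : Word n) → NonZero v → ∃ λ i → ¬ v i ≈ 0#
  nonzeroEntry {n} v = Fin.¬∀⟶∃¬ n _ (λ i → v i ≟ 0#)

  wt-cong : ∀ {n} {v u : Word n} → (∀ i → v i ≈ u i) → wt v ≡ wt u
  wt-cong {zero} _ = ≡.refl
  wt-cong {suc n} {v} {u} v≈u with v zero ≟ 0# | u zero ≟ 0#
  ... | yes _    | yes _    = wt-cong (v≈u ∘ suc)
  ... | no _     | no _     = cong suc (wt-cong (v≈u ∘ suc))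
  ... | yes v₀≈0 | no u₀≉0  = contradiction (≈-trans (≈-sym (v≈u zero)) v₀≈0) u₀≉0
  ... | no v₀≉0  | yes u₀≈0 = contradiction (≈-trans (v≈u zero) u₀≈0) v₀≉0

  wt-zero : ∀ {n} (v : Word n) → IsZero v → wt v ≡ 0
  wt-zero {zero} v _ = ≡.refl
  wt-zero {suc n} v v≈0 with v zero ≟ 0#
  ... | yes _ = wt-zero (v ∘ suc) (v≈0 ∘ suc)
  ... | no v₀≉0 = contradiction (v≈0 zero) v₀≉0

  wt-nonzero : ∀ {n} (v : Word n) → NonZero v → 1 ≤ wt v
  wt-nonzero {zero} v v≉0 = contradiction (λ ()) v≉0
  wt-nonzero {suc n} v v≉0 with v zero ≟ 0#
  ... | yes v₀≈0 = wt-nonzero (v ∘ suc) (λ v′≈0 → v≉0 λ { zero → v₀≈0 ; (suc i) → v′≈0 i })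
  ... | no _ = s≤s z≤n

  ∣p∣≤wt : ∀ {n} (p : Subset n) (v : Word n) → (∀ {j} → j ∈ p → ¬ v j ≈ 0#) → ∣ p ∣ ≤ wt v
  ∣p∣≤wt [] v _ = z≤n
  ∣p∣≤wt (x ∷ p) v p⊆supp with v zero ≟ 0# | x
  ... | yes v₀≈0 | inside  = contradiction v₀≈0 (p⊆supp here)
  ... | yes _    | outside = ∣p∣≤wt p (v ∘ suc) (p⊆supp ∘ there)
  ... | no _     | inside  = s≤s (∣p∣≤wt p (v ∘ suc) (p⊆supp ∘ there))
  ... | no _     | outside = ℕ.m≤n⇒m≤1+n (∣p∣≤wt p (v ∘ suc) (p⊆supp ∘ there))

  wt-punchIn : ∀ {n} (v : Word (suc n)) j → wt v ≤ suc (wt (v ∘ punchIn j))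
  wt-punchIn v zero with v zero ≟ 0#
  ... | yes _ = ℕ.n≤1+n _
  ... | no _ = ℕ.≤-refl
  wt-punchIn {suc n} v (suc j) with v zero ≟ 0#
  ... | yes _ = wt-punchIn (v ∘ suc) j
  ... | no _ = s≤s (wt-punchIn (v ∘ suc) j)

  wt-punchIn-≉0 : ∀ {n} (v : Word (suc n)) j → ¬ v j ≈ 0# → wt v ≡ suc (wt (v ∘ punchIn j))
  wt-punchIn-≉0 v zero vⱼ≉0 with v zero ≟ 0#
  ... | yes v₀≈0 = contradiction v₀≈0 vⱼ≉0
  ... | no _ = ≡.refl
  wt-punchIn-≉0 {suc n} v (suc j) vⱼ≉0 with v zero ≟ 0#
  ... | yes _ = wt-punchIn-≉0 (v ∘ suc) j vⱼ≉0
  ... | no _ = cong suc (wt-punchIn-≉0 (v ∘ suc) j vⱼ≉0)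

  select : ∀ {n} (p : Subset n) → Fin ∣ p ∣ → Fin n
  select (inside ∷ p) zero = zero
  select (inside ∷ p) (suc i) = suc (select p i)
  select (outside ∷ p) i = suc (select p i)

  wt-select : ∀ {n} (p : Subset n) (v : Word n) → (∀ {j} → j ∉ p → v j ≈ 0#) → wt (v ∘ select p) ≡ wt v
  wt-select [] v _ = ≡.refl
  wt-select (inside ∷ p) v v≈0 with v zero ≟ 0#
  ... | yes _ = wt-select p (v ∘ suc) (λ j∉p → v≈0 (j∉p ∘ drop-there))
  ... | no _ = cong suc (wt-select p (v ∘ suc) (λ j∉p → v≈0 (j∉p ∘ drop-there)))
  wt-select (outside ∷ p) v v≈0 with v zero ≟ 0#
  ... | yes _ = wt-select p (v ∘ suc) (λ j∉p → v≈0 (j∉p ∘ drop-there))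
  ... | no v₀≉0 = contradiction (v≈0 λ ()) v₀≉0

  ZeroColumn : ∀ {n m} → Fam n m → Fin n → Set
  ZeroColumn X j = ∀ r → X r j ≈ 0#

  lincomb-reindex : ∀ {n n′ m} a (X : Fam n m) (σ : Fin n′ → Fin n) i →
                    lincomb a (λ r → X r ∘ σ) i ≡ lincomb a X (σ i)
  lincomb-reindex {m = zero} a X σ i = ≡.refl
  lincomb-reindex {m = suc m} a X σ i =
    cong (a zero · X zero (σ i) +ᶠ_) (lincomb-reindex (a ∘ suc) (X ∘ suc) σ i)

  lincomb-scale : ∀ {n n′ m} a (X : Fam n m) (Y : Fam n′ m) {i j} c → (∀ r → X r i ≈ c · Y r j) →
                  lincomb a X i ≈ c · lincomb a Y j
  lincomb-scale {m = zero} a X Y c _ = ≈-sym (proj₂ ·-zero c)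
  lincomb-scale {m = suc m} a X Y {i} {j} c X≈cY = begin
    a zero · X zero i +ᶠ lincomb (a ∘ suc) (X ∘ suc) i
      ≈⟨ +-cong (*-congˡ (X≈cY zero)) (lincomb-scale (a ∘ suc) (X ∘ suc) (Y ∘ suc) c (X≈cY ∘ suc)) ⟩
    a zero · (c · Y zero j) +ᶠ c · lincomb (a ∘ suc) (Y ∘ suc) j
      ≈⟨ +-cong (x·[c·y]≈c·[x·y] (a zero) c (Y zero j)) ≈-refl ⟩
    c · (a zero · Y zero j) +ᶠ c · lincomb (a ∘ suc) (Y ∘ suc) j
      ≈⟨ distribˡ c _ _ ⟨
    c · (a zero · Y zero j +ᶠ lincomb (a ∘ suc) (Y ∘ suc) j) ∎
    where
    open ≈-Reasoning
    x·[c·y]≈c·[x·y] : ∀ x c y → x · (c · y) ≈ c · (x · y)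
    x·[c·y]≈c·[x·y] x c y = begin
      x · (c · y)  ≈⟨ *-assoc x c y ⟨
      (x · c) · y  ≈⟨ *-congʳ (*-comm x c) ⟩
      (c · x) · y  ≈⟨ *-assoc c x y ⟩
      c · (x · y)  ∎

  lincomb-columnCong : ∀ {n n′ m} a (X : Fam n m) (Y : Fam n′ m) {i j} → (∀ r → X r i ≈ Y r j) →
                       lincomb a X i ≈ lincomb a Y j
  lincomb-columnCong a X Y X≈Y =
    ≈-trans (lincomb-scale a X Y 1# (λ r → ≈-trans (X≈Y r) (≈-sym (*-identityˡ _)))) (*-identityˡ _)

  lincomb-zeroColumn : ∀ {n m} a (X : Fam n m) {j} → ZeroColumn X j → lincomb a X j ≈ 0#
  lincomb-zeroColumn a X {j} Xⱼ≈0 = ≈-trans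
    (lincomb-scale a X X 0# (λ r → ≈-trans (Xⱼ≈0 r) (≈-sym (proj₁ ·-zero (X r j)))))
    (proj₁ ·-zero _)

  lincomb-zeroCoefficients : ∀ {n m} a (X : Fam n m) i → (∀ r → a r ≈ 0#) → lincomb a X i ≈ 0#
  lincomb-zeroCoefficients {m = zero} a X i _ = ≈-refl
  lincomb-zeroCoefficients {m = suc m} a X i a≈0 = begin
    a zero · X zero i +ᶠ lincomb (a ∘ suc) (X ∘ suc) i
      ≈⟨ +-cong (≈-trans (*-congʳ (a≈0 zero)) (proj₁ ·-zero _))
                (lincomb-zeroCoefficients (a ∘ suc) (X ∘ suc) i (a≈0 ∘ suc)) ⟩
    0# +ᶠ 0#  ≈⟨ +-identityˡ 0# ⟩
    0#        ∎
    where open ≈-Reasoning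

  row-inSpan : ∀ {n m} (X : Fam n m) r → InSpan X (X r)
  row-inSpan X r = unit r , λ i → ≈-sym (lincomb-unit X r i)
    where
    open ≈-Reasoning
    unit : ∀ {m} → Fin m → Fin m → Carrier
    unit zero zero = 1#
    unit zero (suc _) = 0#
    unit (suc r) zero = 0#
    unit (suc r) (suc l) = unit r l
    lincomb-unit : ∀ {m} (X : Fam _ m) r i → lincomb (unit r) X i ≈ X r i
    lincomb-unit X zero i = begin
      1# · X zero i +ᶠ lincomb (unit zero ∘ suc) (X ∘ suc) i
        ≈⟨ +-cong (*-identityˡ _) (lincomb-zeroCoefficients _ (X ∘ suc) i (λ _ → ≈-refl)) ⟩
      X zero i +ᶠ 0#  ≈⟨ +-identityʳ _ ⟩
      X zero i        ∎
    lincomb-unit X (suc r) i = begin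
      0# · X zero i +ᶠ lincomb (unit r) (X ∘ suc) i
        ≈⟨ +-cong (proj₁ ·-zero _) (lincomb-unit (X ∘ suc) r i) ⟩
      0# +ᶠ X (suc r) i  ≈⟨ +-identityˡ _ ⟩
      X (suc r) i        ∎

  -- Puncturing codes

  GeneratesCode : ∀ {s k} → Fam s k → ℕ → Set
  GeneratesCode G d =
    LinIndep G ×
    (∃ λ v → InSpan G v × NonZero v × wt v ≡ d) ×
    (∀ v → InSpan G v → NonZero v → d ≤ wt v)

  puncture : ∀ {s s′ k} → (Fin s′ → Fin s) → Fam s k → Fam s′ k
  puncture σ G r = G r ∘ σ

  puncture-generatesCode : ∀ {s s′ k} e {c} (σ : Fin s′ → Fin s) (G : Fam s k) → 1 ≤ c →
    LinIndep G → (∀ v → InSpan G v → NonZero v → e + c ≤ wt v) →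
    (∀ v → InSpan G v → wt v ≤ e + wt (v ∘ σ)) →
    (∃ λ v → InSpan G v × wt (v ∘ σ) ≡ c) →
    GeneratesCode (puncture σ G) c
  puncture-generatesCode e {c} σ G c≥1 indep distance lose≤e (v , (b , v≈bG) , wt≡c) =
    indep′ , (v ∘ σ , inSpan′ , v′≉0 , wt≡c) , distance′
    where
    punctured : ∀ a i → lincomb a (puncture σ G) i ≈ lincomb a G (σ i)
    punctured a i = reflexive (lincomb-reindex a G σ i)
    c≤wt∘σ : ∀ a → NonZero (lincomb a G) → c ≤ wt (lincomb a G ∘ σ)
    c≤wt∘σ a u≉0 = ℕ.+-cancelˡ-≤ e _ _
      (ℕ.≤-trans (distance _ (a , λ _ → ≈-refl) u≉0) (lose≤e _ (a , λ _ → ≈-refl)))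
    inSpan′ : InSpan (puncture σ G) (v ∘ σ)
    inSpan′ = b , λ i → ≈-trans (v≈bG (σ i)) (≈-sym (punctured b i))
    v′≉0 : NonZero (v ∘ σ)
    v′≉0 v′≈0 = ℕ.<⇒≢ c≥1 (≡.trans (≡.sym (wt-zero _ v′≈0)) wt≡c)
    indep′ : LinIndep (puncture σ G)
    indep′ a u′≈0 with isZero? (lincomb a G)
    ... | yes u≈0 = indep a u≈0
    ... | no u≉0 = contradiction (≡.subst (c ≤_) wt≡0 (c≤wt∘σ a u≉0)) (ℕ.<⇒≱ c≥1)
      where
      wt≡0 : wt (lincomb a G ∘ σ) ≡ 0
      wt≡0 = wt-zero _ λ i → ≈-trans (≈-sym (punctured a i)) (u′≈0 i)
    distance′ : ∀ u′ → InSpan (puncture σ G) u′ → NonZero u′ → c ≤ wt u′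
    distance′ u′ (a , u′≈aG′) u′≉0 = ≡.subst (c ≤_) wt≡ (c≤wt∘σ a u≉0)
      where
      wt≡ : wt (lincomb a G ∘ σ) ≡ wt u′
      wt≡ = wt-cong λ i → ≈-trans (≈-sym (punctured a i)) (≈-sym (u′≈aG′ i))
      u≉0 : NonZero (lincomb a G)
      u≉0 u≈0 = u′≉0 λ i → ≈-trans (u′≈aG′ i) (≈-trans (punctured a i) (u≈0 (σ i)))

  puncture-outside : ∀ {s k d} (G : Fam s k) (p : Subset s) → (∀ {j} → j ∉ p → ZeroColumn G j) →
                     1 ≤ d → GeneratesCode G d → GeneratesCode (puncture (select p) G) d
  puncture-outside G p zeroOutside d≥1 (indep , (v , v∈G , _ , wt≡d) , distance) =
    puncture-generatesCode 0 (select p) G d≥1 indep distance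
      (λ u u∈G → ℕ.≤-reflexive (≡.sym (wt-select p u (vanishes u∈G))))
      (v , v∈G , ≡.trans (wt-select p v (vanishes v∈G)) wt≡d)
    where
    vanishes : ∀ {u} → InSpan G u → ∀ {j} → j ∉ p → u j ≈ 0#
    vanishes (a , u≈aG) j∉p = ≈-trans (u≈aG _) (lincomb-zeroColumn a G (zeroOutside j∉p))

  lowerDistance : ∀ {s k d} (G : Fam (suc s) k) → 1 ≤ d → GeneratesCode G (suc d) →
                  Σ (Fam s k) λ G′ → GeneratesCode G′ d
  lowerDistance G d≥1 (indep , (v , v∈G , v≉0 , wt≡1+d) , distance) with nonzeroEntry v v≉0
  ... | j , vⱼ≉0 = puncture (punchIn j) G ,
    puncture-generatesCode 1 (punchIn j) G d≥1 indep distance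
      (λ u _ → wt-punchIn u j)
      (v , v∈G , ℕ.suc-injective (≡.trans (≡.sym (wt-punchIn-≉0 v j vⱼ≉0)) wt≡1+d))

  lowerDistanceBy : ∀ {s k} e {d} (G : Fam s k) → 1 ≤ d → GeneratesCode G (e + d) →
                    ∃ λ s′ → s′ + e ≡ s × Σ (Fam s′ k) λ G′ → GeneratesCode G′ d
  lowerDistanceBy zero G _ code = _ , ℕ.+-identityʳ _ , G , code
  lowerDistanceBy {zero} (suc e) G _ (_ , (v , _ , v≉0 , _) , _) = contradiction (λ ()) v≉0
  lowerDistanceBy {suc s} (suc e) {d} G d≥1 code
    with G′ , code′ ← lowerDistance G (ℕ.≤-trans d≥1 (ℕ.m≤n+m d e)) code
    with s′ , s′+e≡s , G″ ← lowerDistanceBy e G′ d≥1 code′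
    = s′ , ≡.trans (ℕ.+-suc s′ e) (cong suc s′+e≡s) , G″

  IsS⇒1≤d : ∀ {d k s} → IsS d k s → 1 ≤ d
  IsS⇒1≤d ((_ , _ , (v , _ , v≉0 , wt≡d) , _) , _) = ≡.subst (1 ≤_) wt≡d (wt-nonzero v v≉0)

  IsS-support-bound : ∀ {s k c d w} (G : Fam s k) (p : Subset s) → IsS c k w → c ≤ d →
    (∀ {j} → j ∉ p → ZeroColumn G j) → GeneratesCode G d → w + (d ∸ c) ≤ ∣ p ∣
  IsS-support-bound {c = c} {d} G p isS@(_ , minimal) c≤d zeroOutside code
    with s′ , s′+e≡∣p∣ , G′ , code′ ←
      lowerDistanceBy (d ∸ c) (puncture (select p) G) (IsS⇒1≤d isS)
        (≡.subst (GeneratesCode _) (≡.sym (ℕ.m∸n+n≡m c≤d))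
          (puncture-outside G p zeroOutside (ℕ.≤-trans (IsS⇒1≤d isS) c≤d) code))
    = ℕ.≤-trans (ℕ.+-monoˡ-≤ (d ∸ c) (minimal s′ (G′ , code′))) (ℕ.≤-reflexive s′+e≡∣p∣)

  -- Orthogonal projections and epipodal vectors

  zeroOut-≈0 : ∀ {n} (x v : Word n) {j} → x j ≈ 0# → zeroOut x v j ≡ v j
  zeroOut-≈0 x v {j} xⱼ≈0 with x j ≟ 0#
  ... | yes _ = ≡.refl
  ... | no xⱼ≉0 = contradiction xⱼ≈0 xⱼ≉0

  zeroOut-≉0 : ∀ {n} (x v : Word n) {j} → ¬ x j ≈ 0# → zeroOut x v j ≡ 0#
  zeroOut-≉0 x v {j} xⱼ≉0 with x j ≟ 0#
  ... | yes xⱼ≈0 = contradiction xⱼ≈0 xⱼ≉0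
  ... | no _ = ≡.refl

  zeroColumn? : ∀ {n m} (X : Fam n m) j → Dec (ZeroColumn X j)
  zeroColumn? X j = Fin.all? (λ r → X r j ≟ 0#)

  nonzeroInColumn : ∀ {n m} (X : Fam n m) {j} → ¬ ZeroColumn X j → ∃ λ r → ¬ X r j ≈ 0#
  nonzeroInColumn {m = m} X {j} = Fin.¬∀⟶∃¬ m _ (λ r → X r j ≟ 0#)

  proj⊥-zeroColumn : ∀ {n} m (X : Fam n m) v {j} → ZeroColumn X j → proj⊥ m X v j ≡ v j
  proj⊥-zeroColumn zero X v _ = ≡.refl
  proj⊥-zeroColumn (suc m) X v X≈0 =
    ≡.trans (zeroOut-≈0 (X zero) _ (X≈0 zero)) (proj⊥-zeroColumn m (X ∘ suc) v (X≈0 ∘ suc))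

  proj⊥-nonzeroColumn : ∀ {n} m (X : Fam n m) v {j} r → ¬ X r j ≈ 0# → proj⊥ m X v j ≡ 0#
  proj⊥-nonzeroColumn (suc m) X v zero Xᵣ≉0 = zeroOut-≉0 (X zero) _ Xᵣ≉0
  proj⊥-nonzeroColumn (suc m) X v {j} (suc r) Xᵣ≉0 with X zero j ≟ 0#
  ... | yes _ = proj⊥-nonzeroColumn m (X ∘ suc) v r Xᵣ≉0
  ... | no _ = ≡.refl

  proj⊥-cong : ∀ {n} m (X Y : Fam n m) v u {j} → (∀ r → X r j ≡ Y r j) → v j ≡ u j →
               proj⊥ m X v j ≡ proj⊥ m Y u j
  proj⊥-cong m X Y v u {j} Xⱼ≡Yⱼ vⱼ≡uⱼ with zeroColumn? X j
  ... | yes X≈0 = ≡.trans (proj⊥-zeroColumn m X v X≈0)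
                   (≡.trans vⱼ≡uⱼ (≡.sym (proj⊥-zeroColumn m Y u λ r → ≡.subst (_≈ 0#) (Xⱼ≡Yⱼ r) (X≈0 r))))
  ... | no X≉0 with r , Xᵣ≉0 ← nonzeroInColumn X X≉0 =
    ≡.trans (proj⊥-nonzeroColumn m X v r Xᵣ≉0)
      (≡.sym (proj⊥-nonzeroColumn m Y u r (Xᵣ≉0 ∘ ≡.subst (_≈ 0#) (≡.sym (Xⱼ≡Yⱼ r)))))

  proj⊥-≡0 : ∀ {n} m (X : Fam n m) v {j} → v j ≡ 0# → proj⊥ m X v j ≡ 0#
  proj⊥-≡0 m X v {j} vⱼ≡0 with zeroColumn? X j
  ... | yes X≈0 = ≡.trans (proj⊥-zeroColumn m X v X≈0) vⱼ≡0
  ... | no X≉0 with r , Xᵣ≉0 ← nonzeroInColumn X X≉0 = proj⊥-nonzeroColumn m X v r Xᵣ≉0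

  proj⊥-zeroPrefix : ∀ {n} a {l} (X : Fam n (a + l)) v {j} → (∀ r → X (r ↑ˡ l) j ≈ 0#) →
                     proj⊥ (a + l) X v j ≡ proj⊥ l (λ r → X (a ↑ʳ r)) v j
  proj⊥-zeroPrefix zero X v _ = ≡.refl
  proj⊥-zeroPrefix (suc a) X v X≈0 =
    ≡.trans (zeroOut-≈0 (X zero) _ (X≈0 zero)) (proj⊥-zeroPrefix a (X ∘ suc) v (X≈0 ∘ suc))

  shift : ∀ {n m} → Fam n (suc m) → Fam n m
  shift X r = zeroOut (X zero) (X (suc r))

  epi-shift : ∀ {n m} (X : Fam n (suc m)) l j → epi (shift X) l j ≡ epi X (suc l) j
  epi-shift X l j = by-cases (X zero j ≟ 0#)
    where
    by-cases : Dec (X zero j ≈ 0#) → epi (shift X) l j ≡ epi X (suc l) j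
    by-cases (yes X₀≈0) = ≡.trans
      (proj⊥-cong (toℕ l) (λ r → shift X (inject r)) (λ r → X (suc (inject r))) (shift X l) (X (suc l))
        (λ r → zeroOut-≈0 (X zero) _ X₀≈0) (zeroOut-≈0 (X zero) _ X₀≈0))
      (≡.sym (zeroOut-≈0 (X zero) _ X₀≈0))
    by-cases (no X₀≉0) = ≡.trans
      (proj⊥-≡0 (toℕ l) (λ r → shift X (inject r)) (shift X l) (zeroOut-≉0 (X zero) _ X₀≉0))
      (≡.sym (zeroOut-≉0 (X zero) _ X₀≉0))

  -- The first row of a proper family is nonzero and the remaining rows, projected away
  -- from it, form a proper family again.
  Proper⇒LinIndep : ∀ {n m} (X : Fam n m) → Proper X → LinIndep X
  Proper⇒LinIndep {m = zero} X _ a _ ()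
  Proper⇒LinIndep {n} {suc m} X proper a aX≈0 = λ { zero → a₀≈0 ; (suc l) → a′≈0 l }
    where
    open ≈-Reasoning
    rest : Word n
    rest = lincomb (a ∘ suc) (X ∘ suc)
    shift-vanishes : IsZero (lincomb (a ∘ suc) (shift X))
    shift-vanishes j with X zero j ≟ 0#
    ... | no X₀≉0 = lincomb-zeroColumn (a ∘ suc) (shift X) λ r → reflexive (zeroOut-≉0 (X zero) _ X₀≉0)
    ... | yes X₀≈0 = begin
      lincomb (a ∘ suc) (shift X) j
        ≈⟨ lincomb-columnCong _ (shift X) (X ∘ suc) (λ r → reflexive (zeroOut-≈0 (X zero) _ X₀≈0)) ⟩
      rest j                        ≈⟨ +-identityˡ _ ⟨
      0# +ᶠ rest j                  ≈⟨ +-cong (≈-trans (*-congˡ X₀≈0) (proj₂ ·-zero _)) ≈-refl ⟨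
      a zero · X zero j +ᶠ rest j   ≈⟨ aX≈0 j ⟩
      0#                            ∎
    a′≈0 : ∀ l → a (suc l) ≈ 0#
    a′≈0 = Proper⇒LinIndep (shift X) shift-proper (a ∘ suc) shift-vanishes
      where
      shift-proper : Proper (shift X)
      shift-proper l ≈0 = proper (suc l) λ j → ≡.subst (_≈ 0#) (epi-shift X l j) (≈0 j)
    a₀X₀≈0 : ∀ j → X zero j · a zero ≈ 0#
    a₀X₀≈0 j = begin
      X zero j · a zero             ≈⟨ *-comm _ _ ⟩
      a zero · X zero j             ≈⟨ +-identityʳ _ ⟨
      a zero · X zero j +ᶠ 0#       ≈⟨ +-cong ≈-refl (lincomb-zeroCoefficients (a ∘ suc) (X ∘ suc) j a′≈0) ⟨
      a zero · X zero j +ᶠ rest j   ≈⟨ aX≈0 j ⟩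
      0#                            ∎
    a₀≈0 : a zero ≈ 0#
    a₀≈0 with j , X₀ⱼ≉0 ← nonzeroEntry (X zero) (proper zero) = x≉0∧x·y≈0⇒y≈0 X₀ⱼ≉0 (a₀X₀≈0 j)

  ForwardReduced⇒GeneratesCode : ∀ {n k} (X : Fam n (suc k)) → Proper X → ForwardReduced X →
                                 GeneratesCode X (wt (X zero))
  ForwardReduced⇒GeneratesCode X proper (X₀≉0 , shortest) =
    Proper⇒LinIndep X proper , (X zero , row-inSpan X zero , X₀≉0 , ≡.refl) , shortest

  -- Projective classes of columns

  Proportional : ∀ {m} → (Fin m → Carrier) → (Fin m → Carrier) → Set
  Proportional x y = ∃ λ c → ¬ c ≈ 0# × (∀ r → x r ≈ c · y r)

  index : Carrier → Fin q
  index x = proj₁ (enum-sur x)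

  index-injective : ∀ x y → toℕ (index x) ≡ toℕ (index y) → x ≈ y
  index-injective x y eq = ≈-trans (≈-sym (proj₂ (enum-sur x)))
    (≈-trans (reflexive (cong enum (Fin.toℕ-injective eq))) (proj₂ (enum-sur y)))

  encode : ∀ {k} → (Fin k → Carrier) → ℕ
  encode {zero} v = 0
  encode {suc k} v = toℕ (index (v zero)) + q * encode (v ∘ suc)

  encode-< : ∀ {k} (v : Fin k → Carrier) → encode v < q ^ k
  encode-< {zero} v = s≤s z≤n
  encode-< {suc k} v = begin-strict
    toℕ (index (v zero)) + q * encode (v ∘ suc)  <⟨ ℕ.+-monoˡ-< _ (Fin.toℕ<n (index (v zero))) ⟩
    q + q * encode (v ∘ suc)                     ≡⟨ ℕ.*-suc q _ ⟨
    q * suc (encode (v ∘ suc))                   ≤⟨ ℕ.*-monoʳ-≤ q (encode-< (v ∘ suc)) ⟩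
    q * q ^ k                                    ∎
    where open ℕ.≤-Reasoning

  encode-injective : ∀ {k} (v u : Fin k → Carrier) → encode v ≡ encode u → ∀ r → v r ≈ u r
  encode-injective {suc k} v u eq
    with index₀≡ , rest≡ ← digits-injective (Fin.toℕ<n (index (v zero))) (Fin.toℕ<n (index (u zero))) eq
    = λ { zero → index-injective _ _ index₀≡ ; (suc r) → encode-injective (v ∘ suc) (u ∘ suc) rest≡ r }

  classes : ℕ → ℕ
  classes m = sumTo (λ t → q ^ suc t) m

  HeadNonzero : ∀ {m} → (Fin (suc m) → Carrier) → Set
  HeadNonzero {m} x = ∃ λ (r : Fin m) → ¬ x (inject₁ r) ≈ 0#

  -- x is scaled so that its first nonzero entry is 1; columns whose first nonzero entry
  -- sits at position r < m then have q^(m−r) codes, q + q² + ⋯ + q^m in total.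
  projectiveCode : ∀ {m} → (Fin (suc m) → Carrier) → ℕ
  projectiveCode {zero} _ = 0
  projectiveCode {suc m} x with x zero ≟ 0#
  ... | yes _ = projectiveCode (x ∘ suc)
  ... | no x₀≉0 = classes m + encode (λ r → proj₁ (inverse _ x₀≉0) · x (suc r))

  headNonzero-tail : ∀ {m} (x : Fin (suc (suc m)) → Carrier) → x zero ≈ 0# → HeadNonzero x →
                     HeadNonzero (x ∘ suc)
  headNonzero-tail x x₀≈0 (zero , x₀≉0) = contradiction x₀≈0 x₀≉0
  headNonzero-tail x _ (suc r , xᵣ≉0) = r , xᵣ≉0

  projectiveCode-< : ∀ {m} (x : Fin (suc m) → Carrier) → HeadNonzero x → projectiveCode x < classes m
  projectiveCode-< {suc m} x head≉0 with x zero ≟ 0#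
  ... | yes x₀≈0 = ℕ.<-≤-trans (projectiveCode-< (x ∘ suc) (headNonzero-tail x x₀≈0 head≉0)) (ℕ.m≤m+n _ _)
  ... | no x₀≉0 = ℕ.+-monoʳ-< (classes m) (encode-< (λ r → proj₁ (inverse _ x₀≉0) · x (suc r)))

  proportional-byNormalisedTail : ∀ {m} (x y : Fin (suc m) → Carrier)
    (x₀≉0 : ¬ x zero ≈ 0#) (y₀≉0 : ¬ y zero ≈ 0#) →
    (∀ r → proj₁ (inverse _ x₀≉0) · x (suc r) ≈ proj₁ (inverse _ y₀≉0) · y (suc r)) →
    Proportional x y
  proportional-byNormalisedTail x y x₀≉0 y₀≉0 normalised =
    x₀ · y₀⁻¹ , x≉0∧y≉0⇒x·y≉0 x₀≉0 (x·y≈1⇒y≉0 y₀·y₀⁻¹≈1) , x≈cy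
    where
    open ≈-Reasoning
    x₀ = x zero
    y₀ = y zero
    x₀⁻¹ = proj₁ (inverse x₀ x₀≉0)
    y₀⁻¹ = proj₁ (inverse y₀ y₀≉0)
    x₀·x₀⁻¹≈1 : x₀ · x₀⁻¹ ≈ 1#
    x₀·x₀⁻¹≈1 = proj₂ (inverse x₀ x₀≉0)
    y₀·y₀⁻¹≈1 : y₀ · y₀⁻¹ ≈ 1#
    y₀·y₀⁻¹≈1 = proj₂ (inverse y₀ y₀≉0)
    x≈cy : ∀ r → x r ≈ (x₀ · y₀⁻¹) · y r
    x≈cy zero = begin
      x₀                   ≈⟨ *-identityʳ x₀ ⟨
      x₀ · 1#              ≈⟨ *-congˡ (≈-trans (≈-sym y₀·y₀⁻¹≈1) (*-comm y₀ y₀⁻¹)) ⟩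
      x₀ · (y₀⁻¹ · y₀)     ≈⟨ *-assoc x₀ y₀⁻¹ y₀ ⟨
      (x₀ · y₀⁻¹) · y₀     ∎
    x≈cy (suc r) = begin
      x (suc r)                 ≈⟨ *-identityˡ _ ⟨
      1# · x (suc r)            ≈⟨ *-congʳ (≈-sym x₀·x₀⁻¹≈1) ⟩
      (x₀ · x₀⁻¹) · x (suc r)   ≈⟨ *-assoc x₀ x₀⁻¹ _ ⟩
      x₀ · (x₀⁻¹ · x (suc r))   ≈⟨ *-congˡ (normalised r) ⟩
      x₀ · (y₀⁻¹ · y (suc r))   ≈⟨ *-assoc x₀ y₀⁻¹ _ ⟨
      (x₀ · y₀⁻¹) · y (suc r)   ∎

  projectiveCode-injective : ∀ {m} (x y : Fin (suc m) → Carrier) → HeadNonzero x → HeadNonzero y →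
                             projectiveCode x ≡ projectiveCode y → Proportional x y
  projectiveCode-injective {suc m} x y x≉0 y≉0 eq with x zero ≟ 0# | y zero ≟ 0#
  ... | yes x₀≈0 | yes y₀≈0
    with c , c≉0 , x′≈cy′ ← projectiveCode-injective (x ∘ suc) (y ∘ suc)
                              (headNonzero-tail x x₀≈0 x≉0) (headNonzero-tail y y₀≈0 y≉0) eq
    = c , c≉0 , λ { zero → ≈-trans x₀≈0 (≈-sym (≈-trans (*-congˡ y₀≈0) (proj₂ ·-zero c)))
                  ; (suc r) → x′≈cy′ r }
  ... | yes x₀≈0 | no _ = contradiction eq (ℕ.<⇒≢ (ℕ.<-≤-trans
          (projectiveCode-< (x ∘ suc) (headNonzero-tail x x₀≈0 x≉0)) (ℕ.m≤m+n _ _)))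
  ... | no _ | yes y₀≈0 = contradiction (≡.sym eq) (ℕ.<⇒≢ (ℕ.<-≤-trans
          (projectiveCode-< (y ∘ suc) (headNonzero-tail y y₀≈0 y≉0)) (ℕ.m≤m+n _ _)))
  ... | no x₀≉0 | no y₀≉0 = proportional-byNormalisedTail x y x₀≉0 y₀≉0
          (encode-injective _ _ (ℕ.+-cancelˡ-≡ (classes m) _ _ eq))

  proportionalColumns-redundant : ∀ {n m} (X : Fam n m) (S : Subset n) →
    (∀ {j} → j ∈ S → ¬ ZeroColumn X j) →
    (∀ {i j} → i ∈ S → j ∈ S → Proportional (λ r → X r i) (λ r → X r j)) →
    Redundant X S
  proportionalColumns-redundant X S nonzero proportional = inSupp , sameZeros
    where
    inSupp : ∀ j → j ∈ S → InSupp X j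
    inSupp j j∈S with r , Xᵣⱼ≉0 ← nonzeroInColumn X (nonzero j∈S) = X r , row-inSpan X r , Xᵣⱼ≉0
    sameZeros : ∀ v → InSpan X v → ∀ i j → i ∈ S → j ∈ S → (v i ≈ 0# ⇔ v j ≈ 0#)
    sameZeros v (a , v≈aX) i j i∈S j∈S with c , c≉0 , Xᵢ≈cXⱼ ← proportional i∈S j∈S =
      mk⇔ (λ vᵢ≈0 → x≉0∧x·y≈0⇒y≈0 c≉0 (≈-trans (≈-sym vᵢ≈c·vⱼ) vᵢ≈0))
          (λ vⱼ≈0 → ≈-trans vᵢ≈c·vⱼ (≈-trans (*-congˡ vⱼ≈0) (proj₂ ·-zero c)))
      where
      vᵢ≈c·vⱼ : v i ≈ c · v j
      vᵢ≈c·vⱼ = ≈-trans (v≈aX i) (≈-trans (lincomb-scale a X X c Xᵢ≈cXⱼ) (*-congˡ (≈-sym (v≈aX j))))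


  -- Coordinates touched by the vectors of a family

  module _ {n K : ℕ} (B : Fam n K) where

    rowsBelow : ∀ a → Fam n a
    rowsBelow a r = at B (toℕ r)

    Untouched : ℕ → Fin n → Set
    Untouched a j = ∀ {s} → s < a → at B s j ≈ 0#

    untouched? : ∀ a j → Dec (Untouched a j)
    untouched? a j = ℕ.allUpTo? (λ s → at B s j ≟ 0#) a

    touched : ∀ a {j} → ¬ Untouched a j → ∃ λ s → s < a × ¬ at B s j ≈ 0#
    touched a {j} ¬untouched with ℕ.anyUpTo? (λ s → ¬? (at B s j ≟ 0#)) a
    ... | yes witness = witness
    ... | no none = ⊥-elim (¬untouched untouched)
      where
      untouched : Untouched a j
      untouched {s} s<a with at B s j ≟ 0#
      ... | yes Bₛⱼ≈0 = Bₛⱼ≈0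
      ... | no Bₛⱼ≉0 = contradiction (s , s<a , Bₛⱼ≉0) none

    untouched-mono : ∀ {a a′ j} → a ≤ a′ → Untouched a′ j → Untouched a j
    untouched-mono a≤a′ untouched s<a = untouched (ℕ.<-≤-trans s<a a≤a′)

    untouched-suc : ∀ {a j} → Untouched a j → at B a j ≈ 0# → Untouched (suc a) j
    untouched-suc untouched Bₐⱼ≈0 s<1+a with ℕ.m≤n⇒m<n∨m≡n (s≤s⁻¹ s<1+a)
    ... | inj₁ s<a = untouched s<a
    ... | inj₂ ≡.refl = Bₐⱼ≈0

    proj⊥-untouched : ∀ {a j} v → Untouched a j → proj⊥ a (rowsBelow a) v j ≡ v j
    proj⊥-untouched {a} v untouched = proj⊥-zeroColumn a (rowsBelow a) v λ r → untouched (Fin.toℕ<n r)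

    proj⊥-touched : ∀ {a j} v → ¬ Untouched a j → proj⊥ a (rowsBelow a) v j ≡ 0#
    proj⊥-touched {a} {j} v ¬untouched with s , s<a , Bₛⱼ≉0 ← touched a ¬untouched =
      proj⊥-nonzeroColumn a (rowsBelow a) v (fromℕ< s<a)
        (Bₛⱼ≉0 ∘ ≡.subst (λ t → at B t j ≈ 0#) (Fin.toℕ-fromℕ< s<a))

    epipodal : ℕ → Word n
    epipodal s = proj⊥ s (rowsBelow s) (at B s)

    at-toℕ : ∀ x → at B (toℕ x) ≡ B x
    at-toℕ x with toℕ x <? K
    ... | yes x<K = cong B (Fin.fromℕ<-toℕ x x<K)
    ... | no x≮K = contradiction (Fin.toℕ<n x) x≮K

    epi≡epipodal : ∀ l j → epi B l j ≡ epipodal (toℕ l) j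
    epi≡epipodal l j = proj⊥-cong (toℕ l) _ (rowsBelow (toℕ l)) (B l) (at B (toℕ l)) sameRows (entry (at-toℕ l))
      where
      entry : ∀ {v u : Word n} → u ≡ v → v j ≡ u j
      entry u≡v = cong (λ v → v j) (≡.sym u≡v)
      sameRows : ∀ r → B (inject r) j ≡ at B (toℕ r) j
      sameRows r = ≡.trans (entry (at-toℕ (inject r))) (cong (λ t → at B t j) (Fin.toℕ-inject r))

    epi-block≡epipodal : ∀ a m l j → epi (block B a m) l j ≡ epipodal (a + toℕ l) j
    epi-block≡epipodal a m l j with untouched? a j
    ... | yes untouched = begin
      epi (block B a m) l j
        ≡⟨ proj⊥-cong L _ (λ r → at B (a + toℕ r)) _ _
             (λ r → ≡.trans (proj⊥-untouched _ untouched) (cong (λ t → at B (a + t) j) (Fin.toℕ-inject r)))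
             (proj⊥-untouched _ untouched) ⟩
      proj⊥ L (λ r → at B (a + toℕ r)) (at B (a + L)) j
        ≡⟨ proj⊥-cong L _ (λ r → rowsBelow (a + L) (a ↑ʳ r)) _ _
             (λ r → cong (λ t → at B t j) (≡.sym (Fin.toℕ-↑ʳ a r))) ≡.refl ⟩
      proj⊥ L (λ r → rowsBelow (a + L) (a ↑ʳ r)) (at B (a + L)) j
        ≡⟨ proj⊥-zeroPrefix a (rowsBelow (a + L)) (at B (a + L))
             (λ r → ≡.subst (λ t → at B t j ≈ 0#) (≡.sym (Fin.toℕ-↑ˡ r L)) (untouched (Fin.toℕ<n r))) ⟨
      epipodal (a + L) j ∎
      where
      open ≡.≡-Reasoning
      L = toℕ l
    ... | no ¬untouched = ≡.trans
      (proj⊥-≡0 (toℕ l) _ (block B a m l) (proj⊥-touched _ ¬untouched))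
      (≡.sym (proj⊥-touched _ (¬untouched ∘ untouched-mono (ℕ.m≤m+n a (toℕ l)))))

    block-proper : ∀ a m → a + m ≤ K → Proper B → Proper (block B a m)
    block-proper a m a+m≤K proper l block⁺≈0 = proper (fromℕ< a+l<K) λ j →
      ≡.subst (_≈ 0#) (≡.sym (sameEpipodal j)) (block⁺≈0 j)
      where
      a+l<K : a + toℕ l < K
      a+l<K = ℕ.<-≤-trans (ℕ.+-monoʳ-< a (Fin.toℕ<n l)) a+m≤K
      sameEpipodal : ∀ j → epi B (fromℕ< a+l<K) j ≡ epi (block B a m) l j
      sameEpipodal j = begin
        epi B (fromℕ< a+l<K) j             ≡⟨ epi≡epipodal (fromℕ< a+l<K) j ⟩
        epipodal (toℕ (fromℕ< a+l<K)) j    ≡⟨ cong (λ t → epipodal t j) (Fin.toℕ-fromℕ< a+l<K) ⟩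
        epipodal (a + toℕ l) j             ≡⟨ epi-block≡epipodal a m l j ⟨
        epi (block B a m) l j              ∎
        where open ≡.≡-Reasoning

    untouchedSet : ℕ → Subset n
    untouchedSet a = subset (untouched? a)

    firstTouched : ℕ → ℕ → Subset n
    firstTouched a b = untouchedSet a ∩ ∁ (untouchedSet b)

    firstTouched⁺ : ∀ {a b j} → Untouched a j → ¬ Untouched b j → j ∈ firstTouched a b
    firstTouched⁺ {a} {b} untouched ¬untouched =
      x∈p∩q⁺ (∈-subset⁺ (untouched? a) untouched , x∉p⇒x∈∁p (¬untouched ∘ ∈-subset⁻ (untouched? b)))

    firstTouched⁻ : ∀ {a b j} → j ∈ firstTouched a b → Untouched a j × ¬ Untouched b j
    firstTouched⁻ {a} {b} j∈ with j∈a , j∈∁b ← x∈p∩q⁻ (untouchedSet a) _ j∈ =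
      ∈-subset⁻ (untouched? a) j∈a , x∈∁p⇒x∉p j∈∁b ∘ ∈-subset⁺ (untouched? b)

    ∣firstTouched∣+∣untouched∣≤∣untouched∣ : ∀ {a b} → a ≤ b →
      ∣ firstTouched a b ∣ + ∣ untouchedSet b ∣ ≤ ∣ untouchedSet a ∣
    ∣firstTouched∣+∣untouched∣≤∣untouched∣ {a} {b} a≤b = q⊆p⇒∣p∩∁q∣+∣q∣≤∣p∣ λ j∈b →
      ∈-subset⁺ (untouched? a) (untouched-mono a≤b (∈-subset⁻ (untouched? b) j∈b))

    ∣firstTouched∣≤∣firstTouched∣+wt : ∀ a b →
      ∣ firstTouched a b ∣ ≤ ∣ firstTouched (suc a) b ∣ + wt (epipodal a)
    ∣firstTouched∣≤∣firstTouched∣+wt a b =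
      ℕ.≤-trans (∣p∣≤∣q∣+∣p∩∁q∣ (firstTouched a b) (firstTouched (suc a) b))
        (ℕ.+-monoʳ-≤ _ (∣p∣≤wt _ (epipodal a) touchedByBₐ))
      where
      touchedByBₐ : ∀ {j} → j ∈ firstTouched a b ∩ ∁ (firstTouched (suc a) b) → ¬ epipodal a j ≈ 0#
      touchedByBₐ j∈ Bₐ⁺ⱼ≈0
        with j∈ab , j∉a+1b ← x∈p∩q⁻ (firstTouched a b) _ j∈
        with untouched , ¬untouched-b ← firstTouched⁻ j∈ab
        = x∈∁p⇒x∉p j∉a+1b (firstTouched⁺
            (untouched-suc untouched (≡.subst (_≈ 0#) (proj⊥-untouched _ untouched) Bₐ⁺ⱼ≈0)) ¬untouched-b)

    block-zeroOutside : ∀ a m {j} → j ∉ firstTouched a (a + m) → ZeroColumn (block B a m) j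
    block-zeroOutside a m {j} j∉ r with untouched? a j | untouched? (a + m) j
    ... | no ¬untouched | _ = reflexive (proj⊥-touched _ ¬untouched)
    ... | yes untouched | yes untouched′ =
      ≡.subst (_≈ 0#) (≡.sym (proj⊥-untouched _ untouched)) (untouched′ (ℕ.+-monoʳ-< a (Fin.toℕ<n r)))
    ... | yes untouched | no ¬untouched′ = contradiction (firstTouched⁺ untouched ¬untouched′) j∉

    firstTouched⇒headNonzero : ∀ a m {j} → j ∈ firstTouched a (a + m) →
                               HeadNonzero (λ r → block B a (suc m) r j)
    firstTouched⇒headNonzero a m {j} j∈
      with untouched , ¬untouched ← firstTouched⁻ j∈
      with s , s<a+m , Bₛⱼ≉0 ← touched (a + m) ¬untouched
      = fromℕ< s∸a<m , Bₛⱼ≉0 ∘ ≡.subst (_≈ 0#) entry≡Bₛⱼ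
      where
      a≤s : a ≤ s
      a≤s = ℕ.≮⇒≥ (λ s<a → Bₛⱼ≉0 (untouched s<a))
      s∸a<m : s ∸ a < m
      s∸a<m = ℕ.+-cancelˡ-< a _ _ (≡.subst (_< a + m) (≡.sym (ℕ.m+[n∸m]≡n a≤s)) s<a+m)
      a+r≡s : a + toℕ (inject₁ (fromℕ< s∸a<m)) ≡ s
      a+r≡s = ≡.trans (cong (a +_) (≡.trans (Fin.toℕ-inject₁ _) (Fin.toℕ-fromℕ< s∸a<m))) (ℕ.m+[n∸m]≡n a≤s)
      entry≡Bₛⱼ : block B a (suc m) (inject₁ (fromℕ< s∸a<m)) j ≡ at B s j
      entry≡Bₛⱼ = ≡.trans (proj⊥-untouched _ untouched) (cong (λ t → at B t j) a+r≡s)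

    ∣firstTouched∣≤classes*η : ∀ a m → BackwardReduced (block B a (suc m)) →
      ∣ firstTouched a (a + m) ∣ ≤ classes m * wt (epipodal (a + m))
    ∣firstTouched∣≤classes*η a m (_ , _ , η-maximal) =
      pigeonhole-fibers (classes m) code T (projectiveCode-< _ ∘ headNonzero) fiber≤η
      where
      D = block B a (suc m)
      T = firstTouched a (a + m)
      column : Fin n → Fin (suc m) → Carrier
      column j r = D r j
      code : Fin n → ℕ
      code j = projectiveCode (column j)
      headNonzero : ∀ {j} → j ∈ T → HeadNonzero (column j)
      headNonzero = firstTouched⇒headNonzero a m
      η≡ : wt (epi D (fromℕ m)) ≡ wt (epipodal (a + m))
      η≡ = wt-cong λ j → reflexive (≡.trans (epi-block≡epipodal a (suc m) (fromℕ m) j)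
                                            (cong (λ t → epipodal (a + t) j) (Fin.toℕ-fromℕ m)))
      fiber≤η : ∀ u → ∣ T ∩ fiber code u ∣ ≤ wt (epipodal (a + m))
      fiber≤η u = ℕ.≤-trans (η-maximal S redundant) (ℕ.≤-reflexive η≡)
        where
        S = T ∩ fiber code u
        inS : ∀ {j} → j ∈ S → j ∈ T × code j ≡ u
        inS j∈S with j∈T , j∈u ← x∈p∩q⁻ T _ j∈S = j∈T , ∈-subset⁻ (λ j → code j ℕ.≟ u) j∈u
        redundant : Redundant D S
        redundant = proportionalColumns-redundant D S
          (λ j∈S D≈0 → let r , Dᵣ≉0 = headNonzero (proj₁ (inS j∈S)) in Dᵣ≉0 (D≈0 (inject₁ r)))
          (λ i∈S j∈S → projectiveCode-injective (column _) (column _)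
             (headNonzero (proj₁ (inS i∈S))) (headNonzero (proj₁ (inS j∈S)))
             (≡.trans (proj₂ (inS i∈S)) (≡.sym (proj₂ (inS j∈S)))))

    forward-block-bounds : ∀ a m {c w} → a + suc m ≤ K → Proper B → ForwardReduced (block B a (suc m)) →
      IsS c (suc m) w → c ≤ wt (epipodal a) →
      w ≤ ∣ firstTouched a (a + suc m) ∣ × w ∸ c ≤ ∣ firstTouched (suc a) (a + suc m) ∣
    forward-block-bounds a m {c} {w} fits proper forward isS c≤d =
      ℕ.m+n≤o⇒m≤o w support-bound ,
      w+[d∸c]≤t+d⇒w∸c≤t c≤d (ℕ.≤-trans support-bound (∣firstTouched∣≤∣firstTouched∣+wt a (a + suc m)))
      where
      G = block B a (suc m)
      d = wt (epipodal a)
      head≡epipodal : ∀ j → G zero j ≡ epipodal a j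
      head≡epipodal j =
        ≡.trans (epi-block≡epipodal a (suc m) zero j) (cong (λ t → epipodal t j) (ℕ.+-identityʳ a))
      code : GeneratesCode G d
      code = ≡.subst (GeneratesCode G) (wt-cong (reflexive ∘ head≡epipodal))
               (ForwardReduced⇒GeneratesCode G (block-proper a (suc m) fits proper) forward)
      support-bound : w + (d ∸ c) ≤ ∣ firstTouched a (a + suc m) ∣
      support-bound = IsS-support-bound G _ isS c≤d (block-zeroOutside a (suc m)) code

    backward-block-bound : ∀ a m → BackwardReduced (block B (suc a) (suc m)) →
      (q ∸ 1) * ∣ firstTouched (suc a) (a + suc m) ∣ ≤ (q ^ suc m ∸ q) * wt (epipodal (a + suc m))
    backward-block-bound a m backward rewrite ℕ.+-suc a m = begin
      (q ∸ 1) * ∣ firstTouched (suc a) (suc a + m) ∣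
        ≤⟨ ℕ.*-monoʳ-≤ (q ∸ 1) (∣firstTouched∣≤classes*η (suc a) m backward) ⟩
      (q ∸ 1) * (classes m * η)    ≡⟨ ℕ.*-assoc (q ∸ 1) (classes m) η ⟨
      (q ∸ 1) * classes m * η      ≡⟨ cong (_* η) (geometric-series q m) ⟩
      (q ^ suc m ∸ q) * η          ∎
      where
      open ℕ.≤-Reasoning
      η = wt (epipodal (suc a + m))

  module _ {n p m : ℕ} (B : Fam n (p * suc m))
    (proper : Proper B)
    (forward : ∀ i → i < p → ForwardReduced (block B (i * suc m) (suc m)))
    (backward : ∀ i → suc i < p → BackwardReduced (block B (i * suc m + 1) (suc m)))
    {c w : ℕ → ℕ}
    (isS : ∀ i → i < p → IsS (c i) (suc m) (w i))
    (recurrence : ∀ i → suc i < p → c (suc i) ≡ ⌈ (q ∸ 1) * (w i ∸ c i) / (q ^ suc m ∸ q) ⌉)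
    where

    β : ℕ
    β = suc m

    d : ℕ → ℕ
    d i = wt (epipodal B (i * β))

    next-start : ∀ i → suc i * β ≡ i * β + β
    next-start i = ℕ.+-comm β (i * β)

    block-bounds : ∀ i → i < p → c i ≤ d i →
      w i ≤ ∣ firstTouched B (i * β) (i * β + β) ∣ × w i ∸ c i ≤ ∣ firstTouched B (suc (i * β)) (i * β + β) ∣
    block-bounds i i<p = forward-block-bounds B (i * β) m fits proper (forward i i<p) (isS i i<p)
      where
      fits : i * β + β ≤ p * β
      fits = ℕ.≤-trans (ℕ.≤-reflexive (≡.sym (next-start i))) (ℕ.*-monoˡ-≤ β i<p)

    c≤d-next : ∀ i → suc i < p → c i ≤ d i → c (suc i) ≤ d (suc i)
    c≤d-next i i+1<p cᵢ≤dᵢ = begin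
      c (suc i)                                       ≡⟨ recurrence i i+1<p ⟩
      ⌈ (q ∸ 1) * (w i ∸ c i) / (q ^ β ∸ q) ⌉         ≤⟨ ⌈/⌉≤ _ (q ^ β ∸ q) _ (begin
        (q ∸ 1) * (w i ∸ c i)                         ≤⟨ ℕ.*-monoʳ-≤ (q ∸ 1) w∸c≤∣T∣ ⟩
        (q ∸ 1) * ∣ firstTouched B (suc a) (a + β) ∣  ≤⟨ backward-block-bound B a m backward′ ⟩
        (q ^ β ∸ q) * wt (epipodal B (a + β))         ∎) ⟩
      wt (epipodal B (a + β))                         ≡⟨ cong (wt ∘ epipodal B) (next-start i) ⟨
      d (suc i)                                       ∎
      where
      open ℕ.≤-Reasoning
      a = i * β
      w∸c≤∣T∣ = proj₂ (block-bounds i (ℕ.<-trans (ℕ.n<1+n i) i+1<p) cᵢ≤dᵢ)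
      backward′ : BackwardReduced (block B (suc a) β)
      backward′ = ≡.subst (λ t → BackwardReduced (block B t β)) (ℕ.+-comm a 1) (backward i i+1<p)

    slide-invariant : c 0 ≤ d 0 → ∀ P → P ≤ p →
      sumTo w P + ∣ untouchedSet B (P * β) ∣ ≤ n × (P < p → c P ≤ d P)
    slide-invariant c₀≤d₀ zero _ = ∣p∣≤n (untouchedSet B 0) , λ _ → c₀≤d₀
    slide-invariant c₀≤d₀ (suc P) P<p = covered′ , λ P+1<p → c≤d-next P P+1<p cₚ≤dₚ
      where
      open ℕ.≤-Reasoning
      a = P * β
      IH = slide-invariant c₀≤d₀ P (ℕ.<⇒≤ P<p)
      cₚ≤dₚ = proj₂ IH P<p
      Σw = sumTo w P
      ∣U∣ : ℕ → ℕ
      ∣U∣ t = ∣ untouchedSet B t ∣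
      ∣K∣ = ∣ firstTouched B a (a + β) ∣
      covered′ : Σw + w P + ∣U∣ (suc P * β) ≤ n
      covered′ = begin
        Σw + w P + ∣U∣ (suc P * β)   ≡⟨ cong (λ t → Σw + w P + ∣U∣ t) (next-start P) ⟩
        Σw + w P + ∣U∣ (a + β)       ≡⟨ ℕ.+-assoc Σw (w P) _ ⟩
        Σw + (w P + ∣U∣ (a + β))     ≤⟨ ℕ.+-monoʳ-≤ Σw (ℕ.+-monoˡ-≤ _ (proj₁ (block-bounds P P<p cₚ≤dₚ))) ⟩
        Σw + (∣K∣ + ∣U∣ (a + β))     ≤⟨ ℕ.+-monoʳ-≤ Σw telescope ⟩
        Σw + ∣U∣ a                   ≤⟨ proj₁ IH ⟩
        n                            ∎
        where
        telescope = ∣firstTouched∣+∣untouched∣≤∣untouched∣ B (ℕ.m≤m+n a β)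

open Codes

mainTheorem7 : ∀ {q : ℕ} (F : FiniteField q) (n p β : ℕ)
    → (p≥1 : 1 ≤ p) (β≥2 : 2 ≤ β)
    → (B : Fam F n (p * β))
    → LinIndep F B
    → SlideReduced F p β B
    → (c w : ℕ → ℕ)
    → c 0 ≡ wt F (B (first F p≥1 β≥2))
    → (∀ i → i < p → IsS F (c i) β (w i))
    → (∀ i → suc i < p → c (suc i) ≡ ⌈ (q ∸ 1) * (w i ∸ c i) / (q ^ β ∸ q) ⌉)
    → sumTo w p ≤ n
mainTheorem7 F n (suc p) (suc m) _ _ B _ (proper , forward , backward) c w c₀≡ isS recurrence =
  ℕ.m+n≤o⇒m≤o (sumTo w (suc p))
    (proj₁ (slide-invariant F B proper forward backward isS recurrence c₀≤d₀ (suc p) ℕ.≤-refl))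
  where
  c₀≤d₀ : c 0 ≤ wt F (epipodal F B 0)
  c₀≤d₀ = ℕ.≤-reflexive (≡.trans c₀≡ (wt-cong F λ j →
            FiniteField.reflexive F (cong (λ v → v j) (≡.sym (at-toℕ F B zero)))))
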